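{- (Internal Banach Fixed-Point Theorem.) For every object $X$ of $\mathcal{S}$, the formula $\forall f:X^X.\ \big((\exists x:X.\top)\wedge\mathrm{Contr}(f)\big)\to\exists!x:X.\ f(x)=x$ holds in the internal logic of $\mathcal{S}$.
   Context: $\mathcal{S}$ is the topos of presheaves on $\omega=\{1,2,\dots\}$ with subobject classifier $\Omega$, $\Omega(n)=\{0,\dots,n\}$, and $\rhd:\Omega\to\Omega$ mapping $k\in\Omega(m)$ to $\min(m,k+1)$. The internal logic is the standard Kripke–Joyal forcing semantics of the topos (a formula holds if it is forced at every stage $n$). For $f:X^X$ (more generally $f:Y^X$), the predicate $\mathrm{Contr}(f)$ is defined internally by $\mathrm{Contr}(f)\Leftrightarrow\forall x,x':X.\ \rhd(x=x')\to f(x)=f(x')$. -}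

module Defs where

-- The topos S of presheaves on ω = {1,2,...} ("topos of trees"), and a shallow
-- embedding of its Kripke–Joyal forcing semantics.
--
-- Convention: the Agda stage index  n : ℕ  denotes the stage  n+1 ∈ ω.
-- A presheaf on the poset ω is (up to equivalence) a sequence of sets X(n)
-- together with restriction maps X(n+1) → X(n); general restrictions are
-- composites of these (functoriality is then automatic).

open import Data.Nat using (ℕ; zero; suc; _≤′_; ≤′-refl; ≤′-step)
open import Data.Unit using (⊤; tt)
open import Data.Product using (Σ; _×_; _,_; proj₁; proj₂)
open import Relation.Binary.PropositionalEquality using (_≡_)

record Psh : Set₁ where
  field
    Ob : ℕ → Set
    rs : ∀ n → Ob (suc n) → Ob n
open Psh public

res : (X : Psh) → ∀ {m n} → m ≤′ n → Ob X n → Ob X m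
res X ≤′-refl x = x
res X (≤′-step p) x = res X p (rs X _ x)

pred≤′ : ∀ {m n} → suc m ≤′ n → m ≤′ n
pred≤′ ≤′-refl = ≤′-step ≤′-refl
pred≤′ (≤′-step p) = ≤′-step (pred≤′ p)

𝟙 : Psh
Ob 𝟙 _ = ⊤
rs 𝟙 _ _ = tt

_⊗_ : Psh → Psh → Psh
Ob (X ⊗ Y) n = Ob X n × Ob Y n
rs (X ⊗ Y) n (x , y) = rs X n x , rs Y n y

-- exponential Y^X :  (Y^X)(n) = Nat(y(n) × X, Y), i.e. natural families
-- f_m : X(m) → Y(m) for m ≤ n.
record Exp (X Y : Psh) (n : ℕ) : Set where
  field
    fun : ∀ m → m ≤′ n → Ob X m → Ob Y m
    nat : ∀ m (p : suc m ≤′ n) (x : Ob X (suc m)) →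
          rs Y m (fun (suc m) p x) ≡ fun m (pred≤′ p) (rs X m x)
open Exp public

rsExp : ∀ {X Y} n → Exp X Y (suc n) → Exp X Y n
fun (rsExp n f) m p = fun f m (≤′-step p)
nat (rsExp n f) m p x = nat f m (≤′-step p) x

_^_ : Psh → Psh → Psh
Ob (Y ^ X) n = Exp X Y n
rs (Y ^ X) n = rsExp n

ev : ∀ {X Y n} → Exp X Y n → Ob X n → Ob Y n
ev {n = n} f x = fun f n ≤′-refl x

-- terms in context Γ of type A, and formulas in context Γ (forcing relation)
-- (wrapped in records so that the context can be inferred)
record Term (Γ A : Psh) : Set where
  constructor term
  field at : ∀ n → Ob Γ n → Ob A n
open Term public

record Formula (Γ : Psh) : Set₁ where
  constructor formula
  field forces : ∀ n → Ob Γ n → Set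
open Formula public

var : ∀ {Γ X} → Term (Γ ⊗ X) X
var = term λ n γx → proj₂ γx

wk : ∀ {Γ X A} → Term Γ A → Term (Γ ⊗ X) A
wk t = term λ n γx → at t n (proj₁ γx)

app : ∀ {Γ X Y} → Term Γ (Y ^ X) → Term Γ X → Term Γ Y
app f x = term λ n γ → ev (at f n γ) (at x n γ)

_[_] : ∀ {Γ Δ} → Formula Γ → Term Δ Γ → Formula Δ
φ [ σ ] = formula λ n δ → forces φ n (at σ n δ)

skip : ∀ {Γ X} → Term ((Γ ⊗ X) ⊗ X) (Γ ⊗ X)
skip = term λ n γxy → proj₁ (proj₁ γxy) , proj₂ γxy

⊤ᶠ : ∀ {Γ} → Formula Γ
⊤ᶠ = formula λ n γ → ⊤

_∧ᶠ_ : ∀ {Γ} → Formula Γ → Formula Γ → Formula Γ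
φ ∧ᶠ ψ = formula λ n γ → forces φ n γ × forces ψ n γ

_⇒ᶠ_ : ∀ {Γ} → Formula Γ → Formula Γ → Formula Γ
_⇒ᶠ_ {Γ} φ ψ = formula λ n γ →
  ∀ m (p : m ≤′ n) → forces φ m (res Γ p γ) → forces ψ m (res Γ p γ)

∀ᶠ : ∀ {Γ} (X : Psh) → Formula (Γ ⊗ X) → Formula Γ
∀ᶠ {Γ} X φ = formula λ n γ →
  ∀ m (p : m ≤′ n) (x : Ob X m) → forces φ m (res Γ p γ , x)

∃ᶠ : ∀ {Γ} (X : Psh) → Formula (Γ ⊗ X) → Formula Γ
∃ᶠ X φ = formula λ n γ → Σ (Ob X n) λ x → forces φ n (γ , x)

_≐_ : ∀ {Γ A} → Term Γ A → Term Γ A → Formula Γ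
t ≐ s = formula λ n γ → at t n γ ≡ at s n γ

∃!ᶠ : ∀ {Γ} (X : Psh) → Formula (Γ ⊗ X) → Formula Γ
∃!ᶠ {Γ} X φ = ∃ᶠ X (φ ∧ᶠ ∀ᶠ X ((φ [ skip ]) ⇒ᶠ (var ≐ wk var)))

-- ▷φ : the formula  ▷(χ_φ) = ⊤ , where ▷ : Ω → Ω, k ∈ Ω(m) ↦ min(m, k+1)
-- and χ_φ is the truth value of φ.
▷ᶠ : ∀ {Γ} → Formula Γ → Formula Γ
▷ᶠ {Γ} φ = formula go
  where
  go : ∀ n → Ob Γ n → Set
  go zero γ = ⊤
  go (suc n) γ = forces φ n (rs Γ n γ)

Contr : ∀ {Γ} (X Y : Psh) → Term Γ (Y ^ X) → Formula Γ
Contr X Y f =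
  ∀ᶠ X (∀ᶠ X (▷ᶠ (wk var ≐ var) ⇒ᶠ (app (wk (wk f)) (wk var) ≐ app (wk (wk f)) var)))

Holds : Formula 𝟙 → Set
Holds φ = ∀ n → forces φ n tt

module Submission where

-- Fix a stage k and a global element g of X^X at stage k, i.e. a natural family
-- of maps g_j : X(j) → X(j) (j ≤ k).  Forcing Contr(g) says exactly that g is
-- contractive: g_j identifies points whose restrictions to stage j-1 agree.
-- By induction on j this makes the iterate g_j^(j+1) constant, since
-- restriction commutes with iteration and the restrictions of two
-- (j+1)-fold iterates are j-fold iterates at the previous stage.  Hence, for
-- any x₀ : X(k) (given by the hypothesis ∃x.⊤), x = g_k^(k+1)(x₀) is a fixed
-- point, and every fixed point z of g_i (i ≤ k) equals the restriction of x,
-- because z = g_i^(k+1)(z) = g_i^(k+1)(x₀|ᵢ) = x|ᵢ.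

open import Defs
open import Data.Nat using (ℕ; zero; suc; _≤′_; ≤′-refl; ≤′-step)
open import Data.Nat.Properties using (≤′-trans; ≤′⇒≤; n≮n; s≤′s)
open import Data.Nat.GeneralisedArithmetic using (fold; iterate-is-fold)
open import Data.Unit using (⊤; tt)
open import Data.Empty using (⊥-elim)
open import Data.Product using (Σ; _×_; _,_; proj₁; proj₂)
open import Relation.Binary.PropositionalEquality
  using (_≡_; refl; sym; trans; cong; cong-app; module ≡-Reasoning)
open ≡-Reasoning

-- Proofs of m ≤′ n are unique; components of natural families therefore do
-- not depend on which proof of j ≤′ k is used to index them.
≤′-irrelevant : ∀ {m n} (p q : m ≤′ n) → p ≡ q
≤′-irrelevant ≤′-refl     ≤′-refl     = refl
≤′-irrelevant ≤′-refl     (≤′-step q) = ⊥-elim (n≮n _ (≤′⇒≤ q))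
≤′-irrelevant (≤′-step p) ≤′-refl     = ⊥-elim (n≮n _ (≤′⇒≤ p))
≤′-irrelevant (≤′-step p) (≤′-step q) = cong ≤′-step (≤′-irrelevant p q)

res-∘ : (A : Psh) {i j k : ℕ} (p : i ≤′ j) (q : j ≤′ k) (a : Ob A k) →
  res A p (res A q a) ≡ res A (≤′-trans p q) a
res-∘ A p ≤′-refl     a = refl
res-∘ A p (≤′-step q) a = res-∘ A p q (rs A _ a)

res-proj₁ : (A B : Psh) {m n : ℕ} (p : m ≤′ n) (e : Ob (A ⊗ B) n) →
  proj₁ (res (A ⊗ B) p e) ≡ res A p (proj₁ e)
res-proj₁ A B ≤′-refl     e = refl
res-proj₁ A B (≤′-step p) e = res-proj₁ A B p (rs (A ⊗ B) _ e)

res-proj₂ : (A B : Psh) {m n : ℕ} (p : m ≤′ n) (e : Ob (A ⊗ B) n) →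
  proj₂ (res (A ⊗ B) p e) ≡ res B p (proj₂ e)
res-proj₂ A B ≤′-refl     e = refl
res-proj₂ A B (≤′-step p) e = res-proj₂ A B p (rs (A ⊗ B) _ e)

fun-irrelevant : ∀ {X Y n} (g : Exp X Y n) j (r s : j ≤′ n) → fun g j r ≡ fun g j s
fun-irrelevant g j r s = cong (fun g j) (≤′-irrelevant r s)

fun-res : ∀ {X Y m n} (g : Exp X Y n) (p : m ≤′ n) j (r : j ≤′ m) (s : j ≤′ n) →
  fun (res (Y ^ X) p g) j r ≡ fun g j s
fun-res g ≤′-refl               j r s = fun-irrelevant g j r s
fun-res g (≤′-step {n = n} p) j r s =
  trans (fun-res (rsExp n g) p j r (≤′-trans r p)) (fun-irrelevant g j _ s)

fun-natural : ∀ {X Y n} (g : Exp X Y n) {a b} (s : a ≤′ b) (r : b ≤′ n) (s' : a ≤′ n)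
  (x : Ob X b) → res Y s (fun g b r x) ≡ fun g a s' (res X s x)
fun-natural g ≤′-refl r s' x = cong-app (fun-irrelevant g _ r s') x
fun-natural {X} {Y} g {a} {suc b} (≤′-step s) r s' x = begin
  res Y s (rs Y b (fun g (suc b) r x))    ≡⟨ cong (res Y s) (nat g b r x) ⟩
  res Y s (fun g b (pred≤′ r) (rs X b x)) ≡⟨ fun-natural g s (pred≤′ r) s' (rs X b x) ⟩
  fun g a s' (res X s (rs X b x))         ∎

-- fⁿ is constant (iterates are written fold z f n = fⁿ(z)).
ConstantIterate : {A : Set} → ℕ → (A → A) → Set
ConstantIterate n f = ∀ y y' → fold y f n ≡ fold y' f n

constant-iterate-mono : {A : Set} {n m : ℕ} (f : A → A) → n ≤′ m →
  ConstantIterate n f → ConstantIterate m f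
constant-iterate-mono f ≤′-refl     const y y' = const y y'
constant-iterate-mono f (≤′-step p) const y y' = cong f (constant-iterate-mono f p const y y')

fold-shift : {A : Set} (f : A → A) (z : A) (n : ℕ) → fold (f z) f n ≡ f (fold z f n)
fold-shift f z n = trans (iterate-is-fold (f z) f n) (sym (iterate-is-fold z f (suc n)))

fold-fixed : {A : Set} (f : A → A) (z : A) → f z ≡ z → ∀ n → fold z f n ≡ z
fold-fixed f z fz≡z zero    = refl
fold-fixed f z fz≡z (suc n) = trans (cong f (fold-fixed f z fz≡z n)) fz≡z

fold-natural : ∀ {X k} (g : Exp X X k) {a b} (s : a ≤′ b) (r : b ≤′ k) (s' : a ≤′ k)
  (y : Ob X b) (n : ℕ) → res X s (fold y (fun g b r) n) ≡ fold (res X s y) (fun g a s') n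
fold-natural g s r s' y zero    = refl
fold-natural g s r s' y (suc n) =
  trans (fun-natural g s r s' _) (cong (fun g _ s') (fold-natural g s r s' y n))

-- x and x' agree one stage earlier: the stage-j meaning of ▷(x = x').
Later : (X : Psh) (j : ℕ) → Ob X j → Ob X j → Set
Later X zero    x x' = ⊤
Later X (suc j) x x' = rs X j x ≡ rs X j x'

Contractive : ∀ {X k} → Exp X X k → Set
Contractive {X} {k} g =
  ∀ j (r : j ≤′ k) x x' → Later X j x x' → fun g j r x ≡ fun g j r x'

IsUniqueFixedPoint : ∀ {X k} → Exp X X k → Ob X k → Set
IsUniqueFixedPoint {X} {k} g x =
  ev g x ≡ x × (∀ i (s : i ≤′ k) z → fun g i s z ≡ z → z ≡ res X s x)

module _ {X : Psh} {k : ℕ} (g : Exp X X k) (contractive : Contractive g) where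

  iterate-constant : ∀ j (r : j ≤′ k) → ConstantIterate (suc j) (fun g j r)
  iterate-constant zero    r y y' = contractive zero r y y' tt
  iterate-constant (suc j) r y y' = contractive (suc j) r _ _ (begin
    rs X j (fold y g₊ (suc j))    ≡⟨ fold-natural g one r (pred≤′ r) y (suc j) ⟩
    fold (rs X j y) gⱼ (suc j)    ≡⟨ iterate-constant j (pred≤′ r) _ _ ⟩
    fold (rs X j y') gⱼ (suc j)   ≡⟨ sym (fold-natural g one r (pred≤′ r) y' (suc j)) ⟩
    rs X j (fold y' g₊ (suc j))   ∎)
    where
    g₊ : Ob X (suc j) → Ob X (suc j)
    g₊ = fun g (suc j) r
    gⱼ : Ob X j → Ob X j
    gⱼ = fun g j (pred≤′ r)
    one : j ≤′ suc j
    one = ≤′-step ≤′-refl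

  banach : Ob X k → Σ (Ob X k) (IsUniqueFixedPoint g)
  banach x₀ = x , is-fixed , unique
    where
    F : Ob X k → Ob X k
    F = fun g k ≤′-refl
    x : Ob X k
    x = fold x₀ F (suc k)

    is-fixed : F x ≡ x
    is-fixed = begin
      F x                   ≡⟨ sym (fold-shift F x₀ (suc k)) ⟩
      fold (F x₀) F (suc k) ≡⟨ iterate-constant k ≤′-refl (F x₀) x₀ ⟩
      x                     ∎

    unique : ∀ i (s : i ≤′ k) z → fun g i s z ≡ z → z ≡ res X s x
    unique i s z fixed = begin
      z                                ≡⟨ sym (fold-fixed gᵢ z fixed (suc k)) ⟩
      fold z gᵢ (suc k)                ≡⟨ constant-iterate-mono gᵢ (s≤′s s)
                                            (iterate-constant i s) z (res X s x₀) ⟩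
      fold (res X s x₀) gᵢ (suc k)     ≡⟨ sym (fold-natural g s ≤′-refl s x₀ (suc k)) ⟩
      res X s x                        ∎
      where
      gᵢ : Ob X i → Ob X i
      gᵢ = fun g i s

module _ {Γ X : Psh} {k : ℕ} (γ : Ob Γ k) (g : Exp X X k) where

  forces-Contr⇒Contractive : forces (Contr X X var) k (γ , g) → Contractive g
  forces-Contr⇒Contractive C j r x x' later = begin
    fun g j r x   ≡⟨ cong-app (sym component) x ⟩
    ev gⱼ x       ≡⟨ C j r x j ≤′-refl x' j ≤′-refl (▷-later j _ later) ⟩
    ev gⱼ x'      ≡⟨ cong-app component x' ⟩
    fun g j r x'  ∎
    where
    gⱼ : Exp X X j
    gⱼ = proj₂ (res (Γ ⊗ (X ^ X)) r (γ , g))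
    component : fun gⱼ j ≤′-refl ≡ fun g j r
    component = trans (cong (λ h → fun h j ≤′-refl) (res-proj₂ Γ (X ^ X) r (γ , g)))
                      (fun-res g r j ≤′-refl r)
    ▷-later : ∀ j (δ : Ob (Γ ⊗ (X ^ X)) j) {x x'} → Later X j x x' →
      forces (▷ᶠ {((Γ ⊗ (X ^ X)) ⊗ X) ⊗ X} (wk var ≐ var)) j ((δ , x) , x')
    ▷-later zero    δ _     = tt
    ▷-later (suc j) δ later = later

  UniqueFixedPoint⇒forces-∃! : Σ (Ob X k) (IsUniqueFixedPoint g) →
    forces (∃!ᶠ X (app (wk var) var ≐ var)) k (γ , g)
  UniqueFixedPoint⇒forces-∃! (x , is-fixed , unique) = x , is-fixed , uniqueness
    where
    Δ : Psh
    Δ = Γ ⊗ (X ^ X)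
    uniqueness : forces (∀ᶠ X (((app (wk var) var ≐ var) [ skip ]) ⇒ᶠ (var ≐ wk var)))
                        k ((γ , g) , x)
    uniqueness m p y m' p' fixed = begin
      z                ≡⟨ unique m' s z (trans (cong-app (sym restricted-function) z) fixed) ⟩
      res X s x        ≡⟨ sym restricted-point ⟩
      proj₂ (proj₁ E)  ∎
      where
      s : m' ≤′ k
      s = ≤′-trans p' p
      e : Ob (Δ ⊗ X) m
      e = res (Δ ⊗ X) p ((γ , g) , x)
      E : Ob ((Δ ⊗ X) ⊗ X) m'
      E = res ((Δ ⊗ X) ⊗ X) p' (e , y)
      z : Ob X m'
      z = proj₂ E
      restricted-point : proj₂ (proj₁ E) ≡ res X s x
      restricted-point = begin
        proj₂ (proj₁ E)           ≡⟨ cong proj₂ (res-proj₁ (Δ ⊗ X) X p' (e , y)) ⟩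
        proj₂ (res (Δ ⊗ X) p' e)  ≡⟨ res-proj₂ Δ X p' e ⟩
        res X p' (proj₂ e)        ≡⟨ cong (res X p') (res-proj₂ Δ X p ((γ , g) , x)) ⟩
        res X p' (res X p x)      ≡⟨ res-∘ X p' p x ⟩
        res X s x                 ∎
      restricted-exp : proj₂ (proj₁ (proj₁ E)) ≡ res (X ^ X) s g
      restricted-exp = begin
        proj₂ (proj₁ (proj₁ E))
          ≡⟨ cong (λ e' → proj₂ (proj₁ e')) (res-proj₁ (Δ ⊗ X) X p' (e , y)) ⟩
        proj₂ (proj₁ (res (Δ ⊗ X) p' e))
          ≡⟨ cong proj₂ (res-proj₁ Δ X p' e) ⟩
        proj₂ (res Δ p' (proj₁ e))
          ≡⟨ res-proj₂ Γ (X ^ X) p' (proj₁ e) ⟩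
        res (X ^ X) p' (proj₂ (proj₁ e))
          ≡⟨ cong (λ e' → res (X ^ X) p' (proj₂ e')) (res-proj₁ Δ X p ((γ , g) , x)) ⟩
        res (X ^ X) p' (proj₂ (res Δ p (γ , g)))
          ≡⟨ cong (res (X ^ X) p') (res-proj₂ Γ (X ^ X) p (γ , g)) ⟩
        res (X ^ X) p' (res (X ^ X) p g)
          ≡⟨ res-∘ (X ^ X) p' p g ⟩
        res (X ^ X) s g
          ∎
      restricted-function : ev (proj₂ (proj₁ (proj₁ E))) ≡ fun g m' s
      restricted-function =
        trans (cong (λ h → fun h m' ≤′-refl) restricted-exp) (fun-res g s m' ≤′-refl s)

theorem2p9 : (X : Psh) →
    Holds (∀ᶠ (X ^ X)
    ((∃ᶠ X ⊤ᶠ ∧ᶠ Contr X X var)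
    ⇒ᶠ ∃!ᶠ X (app (wk var) var ≐ var)))
theorem2p9 X n m p f k q ((x₀ , _) , contr) =
  UniqueFixedPoint⇒forces-∃! (proj₁ env) g (banach g contractive x₀)
  where
  env : Ob (𝟙 ⊗ (X ^ X)) k
  env = res (𝟙 ⊗ (X ^ X)) q (res 𝟙 p tt , f)
  g : Exp X X k
  g = proj₂ env
  contractive : Contractive g
  contractive = forces-Contr⇒Contractive (proj₁ env) g contr
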